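{- Let $\mathcal{A}$ be a union-closed family with universe $[n]$ and length $\ell$, let $C_1=[n]\supsetneq C_2\supsetneq\cdots\supsetneq C_{\ell+1}$ be a chain in $\mathcal{A}$ of maximum size, and define $\mathcal{C}_i$ and $\mathcal{D}_i$ for $i\in[\ell]$ as in the context. For any $i\in[\ell]$, if $C_{i+1}\neq\emptyset$, then $\mathcal{D}_i$ is union-closed.
   Context: A family is a finite family of distinct finite sets, at least one of which is nonempty; its universe is $U(\mathcal{A})=\bigcup_{A\in\mathcal{A}}A$. $\mathcal{A}$ is union-closed if $X_1,X_2\in\mathcal{A}$ implies $X_1\cup X_2\in\mathcal{A}$. A chain is a subfamily any two of whose members are comparable under inclusion; the length $\ell(\mathcal{A})$ is one less than the maximum size of a chain in $\mathcal{A}$. Note that $[n]\in\mathcal{A}$ and belongs to every maximum chain, so a maximum chain can be written $C_1=[n]\supsetneq C_2\supsetneq\cdots\supsetneq C_{\ell+1}$. With $[0]=\emptyset$, for each $i\in[\ell]$ define \[\mathcal{C}_i=\Big\{X\in\mathcal{A} : C_i\setminus C_{i+1}\subseteq X \text{ and } X\cap \textstyle\bigcup_{j\in[i-1]}(C_j\setminus C_{j+1})=\emptyset\Big\},\qquad \mathcal{D}_i=\{X\setminus (C_i\setminus C_{i+1}) : X\in\mathcal{C}_i\}.\] -}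

module Defs where

open import Data.Nat using (ℕ; suc; _≤_; _<?_)
open import Data.Fin using (Fin; zero; suc; inject₁; toℕ)
open import Data.Fin.Subset using (Subset; _∈_; _⊆_; _⊂_; _∪_; _∩_; _─_; ⋃; ⊥; ⊤; Nonempty)
open import Data.List using (List; length; map; filter; allFin)
open import Data.List.Relation.Unary.All using (All)
open import Data.List.Relation.Unary.AllPairs using (AllPairs)
open import Data.List.Relation.Unary.Unique.Propositional using (Unique)
open import Data.Product using (Σ; ∃; _×_)
open import Data.Sum using (_⊎_)
open import Relation.Binary.PropositionalEquality using (_≡_)

-- A family of subsets of [n] (elements of [n] represented by Fin n),
-- given by its membership predicate.  Distinctness and finiteness are automatic.
Family : ℕ → Set₁
Family n = Subset n → Set

HasNonemptyMember : ∀ {n} → Family n → Set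
HasNonemptyMember A = ∃ λ X → A X × Nonempty X

HasUniverseAll : ∀ {n} → Family n → Set
HasUniverseAll {n} A = (x : Fin n) → ∃ λ X → A X × x ∈ X

UnionClosed : ∀ {n} → Family n → Set
UnionClosed A = ∀ X Y → A X → A Y → A (X ∪ Y)

Comparable : ∀ {n} → Subset n → Subset n → Set
Comparable X Y = X ⊆ Y ⊎ Y ⊆ X

IsChain : ∀ {n} → Family n → List (Subset n) → Set
IsChain A cs = Unique cs × All A cs × AllPairs Comparable cs

HasLength : ∀ {n} → Family n → ℕ → Set
HasLength A ℓ =
  (∃ λ cs → IsChain A cs × length cs ≡ suc ℓ) ×
  (∀ cs → IsChain A cs → length cs ≤ suc ℓ)

-- C : Fin (ℓ+1) → Subset n, where C k stands for C_{k+1};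
-- C_1 = [n] ⊋ C_2 ⊋ ... ⊋ C_{ℓ+1}, all members of A (a chain of size ℓ+1).
IsMaxChainSeq : ∀ {n} → Family n → (ℓ : ℕ) → (Fin (suc ℓ) → Subset n) → Set
IsMaxChainSeq A ℓ C =
  (∀ k → A (C k)) × (C zero ≡ ⊤) × (∀ (i : Fin ℓ) → C (suc i) ⊂ C (inject₁ i))

-- for i : Fin ℓ (i.e. paper index i+1 ∈ [ℓ]): C_i ∖ C_{i+1}
layer : ∀ {n ℓ} → (Fin (suc ℓ) → Subset n) → Fin ℓ → Subset n
layer C i = C (inject₁ i) ─ C (suc i)

prefixUnion : ∀ {n ℓ} → (Fin (suc ℓ) → Subset n) → Fin ℓ → Subset n
prefixUnion {ℓ = ℓ} C i =
  ⋃ (map (layer C) (filter (λ j → toℕ j <? toℕ i) (allFin ℓ)))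

Cfam : ∀ {n ℓ} → Family n → (Fin (suc ℓ) → Subset n) → Fin ℓ → Family n
Cfam A C i X = A X × (layer C i ⊆ X) × (X ∩ prefixUnion C i ≡ ⊥)

Dfam : ∀ {n ℓ} → Family n → (Fin (suc ℓ) → Subset n) → Fin ℓ → Family n
Dfam A C i Y = ∃ λ X → Cfam A C i X × Y ≡ X ─ layer C i

module Submission where

open import Defs
open import Data.Nat using (ℕ; suc)
open import Data.Fin using (Fin; suc)
open import Data.Fin.Subset using (Subset; ⊥; _∪_; _∩_; _─_; _⊆_; inside; outside)
open import Data.Fin.Subset.Properties using (p⊆p∪q; ∩-distribʳ-∪; ∪-identityˡ)
open import Data.Product using (∃; _×_; _,_)
open import Data.Vec using (_∷_; [])
open import Function using (_∘_)
open import Relation.Binary.PropositionalEquality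
  using (_≡_; _≢_; refl; cong; cong₂; sym; module ≡-Reasoning)

-- Both conditions cutting 𝒞ᵢ out of A (containing Cᵢ ∖ Cᵢ₊₁, avoiding the
-- earlier layers) survive unions, and X ↦ X ∖ (Cᵢ ∖ Cᵢ₊₁) commutes with unions.

─-distribʳ-∪ : ∀ {n} (r p q : Subset n) → (p ∪ q) ─ r ≡ (p ─ r) ∪ (q ─ r)
─-distribʳ-∪ []            []      []      = refl
─-distribʳ-∪ (inside  ∷ r) (x ∷ p) (y ∷ q) = cong (outside ∷_) (─-distribʳ-∪ r p q)
─-distribʳ-∪ (outside ∷ r) (x ∷ p) (y ∷ q) = cong (_ ∷_) (─-distribʳ-∪ r p q)

∪-disjoint : ∀ {n} {P X Y : Subset n} →
  X ∩ P ≡ ⊥ → Y ∩ P ≡ ⊥ → (X ∪ Y) ∩ P ≡ ⊥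
∪-disjoint {P = P} {X} {Y} X∩P≡⊥ Y∩P≡⊥ = begin
  (X ∪ Y) ∩ P        ≡⟨ ∩-distribʳ-∪ P X Y ⟩
  (X ∩ P) ∪ (Y ∩ P)  ≡⟨ cong₂ _∪_ X∩P≡⊥ Y∩P≡⊥ ⟩
  ⊥ ∪ ⊥              ≡⟨ ∪-identityˡ ⊥ ⟩
  ⊥                  ∎
  where open ≡-Reasoning

Cfam-unionClosed : ∀ {n ℓ} {A : Family n} (C : Fin (suc ℓ) → Subset n) (i : Fin ℓ) →
  UnionClosed A → UnionClosed (Cfam A C i)
Cfam-unionClosed C i uc X Y (X∈A , L⊆X , X∩P≡⊥) (Y∈A , _ , Y∩P≡⊥) =
  uc X Y X∈A Y∈A , p⊆p∪q Y ∘ L⊆X , ∪-disjoint X∩P≡⊥ Y∩P≡⊥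

─-image-unionClosed : ∀ {n} {B : Family n} (L : Subset n) →
  UnionClosed B → UnionClosed (λ Y → ∃ λ X → B X × Y ≡ X ─ L)
─-image-unionClosed L uc _ _ (X , X∈B , refl) (Y , Y∈B , refl) =
  X ∪ Y , uc X Y X∈B Y∈B , sym (─-distribʳ-∪ L X Y)

theorem3p1 : (n : ℕ) (A : Family n) → HasNonemptyMember A → UnionClosed A →
    HasUniverseAll A → (ℓ : ℕ) → HasLength A ℓ →
    (C : Fin (suc ℓ) → Subset n) → IsMaxChainSeq A ℓ C →
    (i : Fin ℓ) → C (suc i) ≢ ⊥ → UnionClosed (Dfam A C i)
theorem3p1 _ _ _ uc _ _ _ C _ i _ =
  ─-image-unionClosed (layer C i) (Cfam-unionClosed C i uc)
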